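{- In the deduction system DBL, for all formulas $\phi,\psi,\eta\in\mathcal{L}$ the sequent $\psi\leftrightarrow\eta\vdash(\phi|\psi)\leftrightarrow(\phi|\eta)$ is derivable (this derivation uses axiom (b5) of DBL and none of the axioms specific to DBL$_\ast$).
   Context: Fix a finite set $\Theta$ of atomic propositions and a distinguished $\theta_1\in\Theta$. The language $\mathcal{L}$ is the smallest set containing $\Theta$ such that $\neg\phi$, $\phi\rightarrow\psi$ and $(\psi|\phi)$ belong to $\mathcal{L}$ whenever $\phi,\psi\in\mathcal{L}$. Abbreviations: $\phi\vee\psi:=\neg\phi\rightarrow\psi$, $\phi\wedge\psi:=\neg(\neg\phi\vee\neg\psi)$, $\phi\leftrightarrow\psi:=(\phi\rightarrow\psi)\wedge(\psi\rightarrow\phi)$, $\psi\times\phi:=(\psi|\phi)\leftrightarrow\psi$, $\top:=\theta_1\rightarrow\theta_1$, $\bot:=\neg\top$. A sequent is a pair of finite (possibly empty) sequences $\Gamma,\Delta$ of formulas of $\mathcal{L}$, written $\Gamma\vdash\Delta$; "$\Gamma,\Delta$" denotes concatenation and $\{\Gamma\}$ the set of entries of $\Gamma$. DBL is the smallest set of sequents $X$ satisfying, for all $\phi,\psi,\eta\in\mathcal{L}$ and finite sequences $\Gamma,\Delta,\Lambda,\Sigma$: (CUT) if $\Gamma\vdash\Delta,\phi$ and $\Lambda,\phi\vdash\Sigma$ are in $X$ then $\Gamma,\Lambda\vdash\Delta,\Sigma$ is in $X$; (STRUCT) if $\{\Gamma\}\subset\{\Lambda\}\cup\{\top\}$, $\{\Delta\}\subset\{\Sigma\}\cup\{\bot\}$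 and $\Gamma\vdash\Delta$ is in $X$ then $\Lambda\vdash\Sigma$ is in $X$; (modus ponens) $\phi,\phi\rightarrow\psi\vdash\psi$; (c1) $\vdash\phi\rightarrow(\psi\rightarrow\phi)$; (c2) $\vdash(\eta\rightarrow(\phi\rightarrow\psi))\rightarrow((\eta\rightarrow\phi)\rightarrow(\eta\rightarrow\psi))$; (c3) $\vdash(\neg\phi\rightarrow\neg\psi)\rightarrow((\neg\phi\rightarrow\psi)\rightarrow\phi)$; (b1) $\phi\rightarrow\psi\vdash\neg\phi,(\psi|\phi)$; (b2) $\vdash(\psi\rightarrow\eta|\phi)\rightarrow((\psi|\phi)\rightarrow(\eta|\phi))$; (b3) $\vdash(\psi|\phi)\rightarrow(\phi\rightarrow\psi)$; (b4) $\vdash\neg(\neg\psi|\phi)\leftrightarrow(\psi|\phi)$; (b5) $\psi\times\phi\vdash\phi\times\psi$. (DBL$_\ast$ is the analogous system with (b5) replaced by (b5.weak.A) $\psi\times\neg\phi\vdash\psi\times\phi$ and $\psi\times\phi\vdash\psi\times\neg\phi$, and (b5.weak.B) $\psi\leftrightarrow\eta\vdash(\phi|\psi)\leftrightarrow(\phi|\eta)$.) A sequent is derivable if it belongs to the system. -}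

module Defs where

open import Data.Nat using (ℕ; suc)
open import Data.Fin using (Fin; zero)
open import Data.List using (List; []; _∷_; _++_; [_])
open import Data.List.Membership.Propositional using (_∈_)
open import Data.Sum using (_⊎_)
open import Relation.Binary.PropositionalEquality using (_≡_)

-- Atomic propositions: Θ = Fin (suc k) (finite, nonempty); θ₁ = zero.
data Form (k : ℕ) : Set where
  atom : Fin (suc k) → Form k
  ¬_   : Form k → Form k
  _⇒_  : Form k → Form k → Form k
  _∣_  : Form k → Form k → Form k

infixr 5 _⇒_
infix 7 ¬_
infix 6 _∣_

module _ {k : ℕ} where
  θ₁ : Form k
  θ₁ = atom zero

  _∨_ : Form k → Form k → Form k
  φ ∨ ψ = (¬ φ) ⇒ ψ

  _∧_ : Form k → Form k → Form k
  φ ∧ ψ = ¬ ((¬ φ) ∨ (¬ ψ))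

  _⇔_ : Form k → Form k → Form k
  φ ⇔ ψ = (φ ⇒ ψ) ∧ (ψ ⇒ φ)

  _×ᶠ_ : Form k → Form k → Form k
  ψ ×ᶠ φ = (ψ ∣ φ) ⇔ ψ

  ⊤ᶠ : Form k
  ⊤ᶠ = θ₁ ⇒ θ₁

  ⊥ᶠ : Form k
  ⊥ᶠ = ¬ ⊤ᶠ

record Sequent (k : ℕ) : Set where
  constructor _⊢_
  field
    ante : List (Form k)
    succ : List (Form k)

infix 3 _⊢_

EntriesIn : ∀ {k} → List (Form k) → List (Form k) → Form k → Set
EntriesIn Γ Λ x = ∀ {χ} → χ ∈ Γ → χ ∈ Λ ⊎ χ ≡ x

data DBL {k : ℕ} : Sequent k → Set where
  cut : ∀ {Γ Δ Λ Σ φ} →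
        DBL (Γ ⊢ Δ ++ [ φ ]) → DBL (Λ ++ [ φ ] ⊢ Σ) → DBL (Γ ++ Λ ⊢ Δ ++ Σ)
  struct : ∀ {Γ Δ Λ Σ} →
        EntriesIn Γ Λ ⊤ᶠ → EntriesIn Δ Σ ⊥ᶠ → DBL (Γ ⊢ Δ) → DBL (Λ ⊢ Σ)
  mp : ∀ φ ψ → DBL (φ ∷ (φ ⇒ ψ) ∷ [] ⊢ [ ψ ])
  c1 : ∀ φ ψ → DBL ([] ⊢ [ φ ⇒ (ψ ⇒ φ) ])
  c2 : ∀ η φ ψ → DBL ([] ⊢ [ (η ⇒ (φ ⇒ ψ)) ⇒ ((η ⇒ φ) ⇒ (η ⇒ ψ)) ])
  c3 : ∀ φ ψ → DBL ([] ⊢ [ ((¬ φ) ⇒ (¬ ψ)) ⇒ (((¬ φ) ⇒ ψ) ⇒ φ) ])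
  b1 : ∀ φ ψ → DBL ([ φ ⇒ ψ ] ⊢ (¬ φ) ∷ (ψ ∣ φ) ∷ [])
  b2 : ∀ φ ψ η → DBL ([] ⊢ [ ((ψ ⇒ η) ∣ φ) ⇒ ((ψ ∣ φ) ⇒ (η ∣ φ)) ])
  b3 : ∀ φ ψ → DBL ([] ⊢ [ (ψ ∣ φ) ⇒ (φ ⇒ ψ) ])
  b4 : ∀ φ ψ → DBL ([] ⊢ [ (¬ ((¬ ψ) ∣ φ)) ⇔ (ψ ∣ φ) ])
  b5 : ∀ φ ψ → DBL ([ ψ ×ᶠ φ ] ⊢ [ φ ×ᶠ ψ ])

{-# OPTIONS --safe #-}
-- Read ψ ×ᶠ φ as "ψ is independent of φ". By (b5) independence is symmetric, and
-- ψ ×ᶠ φ holds whenever φ does (b3, b4); together these give necessitation, from ψ infer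
-- (ψ ∣ φ), and hence (b2) congruence of (_ ∣ φ) under equivalence. Axiom (b1) turns
-- φ ⇒ χ into a case split: ¬ φ, where every formula is independent of φ, or (χ ∣ φ).
-- Splitting on ψ ⇒ φ ×ᶠ ψ shows that (φ ∣ ψ) is independent of ψ, hence of η when
-- ψ ⇔ η, i.e. ((φ ∣ ψ) ∣ η) ⇔ (φ ∣ ψ). Splitting on η ⇒ φ ×ᶠ ψ then yields
-- ((φ ∣ ψ) ∣ η) ⇔ (φ ∣ η), unless ¬ η, in which case ¬ ψ too and both conditionals are
-- equivalent to φ.
module Submission where

open import Data.Nat using (ℕ)
open import Data.List using (List; []; _∷_; _++_; [_])
open import Data.List.Properties using (++-identityʳ)
open import Data.List.Membership.Propositional.Properties using (∈-++⁻)
open import Data.List.Relation.Binary.Subset.Propositional using (_⊆_)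
open import Data.List.Relation.Binary.Subset.Propositional.Properties
  using (⊆-refl; ⊆-reflexive; ⊆-reflexive-↭; xs⊆x∷xs; ∈-∷⁺ʳ)
open import Data.List.Relation.Binary.Permutation.Propositional.Properties using (++-comm)
open import Data.List.Relation.Unary.Any using (here)
open import Data.Sum using (inj₁; [_,_]′)
open import Function using (_∘_)
open import Relation.Binary.PropositionalEquality using (refl)
open import Defs

private
  variable
    k : ℕ
    Γ Δ Λ Σ : List (Form k)
    φ ψ η χ A B C X Y : Form k

++-lub : Γ ⊆ Σ → Λ ⊆ Σ → Γ ++ Λ ⊆ Σ
++-lub {Γ = Γ} p q = [ p , q ]′ ∘ ∈-++⁻ Γ

weaken : Γ ⊆ Λ → Δ ⊆ Σ → DBL (Γ ⊢ Δ) → DBL (Λ ⊢ Σ)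
weaken p q = struct (inj₁ ∘ p) (inj₁ ∘ q)

cut-head : DBL (Γ ⊢ φ ∷ Δ) → DBL (φ ∷ Λ ⊢ Σ) → DBL (Γ ++ Λ ⊢ Δ ++ Σ)
cut-head {φ = φ} {Δ = Δ} {Λ = Λ} d e =
  cut (weaken ⊆-refl (⊆-reflexive-↭ (++-comm [ φ ] Δ)) d)
      (weaken (⊆-reflexive-↭ (++-comm [ φ ] Λ)) ⊆-refl e)

cases : DBL (Γ ⊢ A ∷ B ∷ []) → DBL (A ∷ Γ ⊢ [ C ]) → DBL (B ∷ Γ ⊢ [ C ]) → DBL (Γ ⊢ [ C ])
cases d a b =
  weaken (++-lub (++-lub ⊆-refl ⊆-refl) ⊆-refl) (++-lub ⊆-refl ⊆-refl) (cut-head (cut-head d a) b)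

_⊩_ : List (Form k) → Form k → Set
Γ ⊩ A = DBL (Γ ⊢ [ A ])

infix 3 _⊩_

⊩-apply : Γ ⊩ A → DBL ([ A ] ⊢ Δ) → DBL (Γ ⊢ Δ)
⊩-apply {Γ = Γ} a r = weaken (⊆-reflexive (++-identityʳ Γ)) ⊆-refl (cut-head a r)

⊩-mp : Γ ⊩ A ⇒ B → Γ ⊩ A → Γ ⊩ B
⊩-mp {Γ = Γ} {A = A} {B = B} f a =
  weaken (++-lub ⊆-refl ⊆-refl) ⊆-refl
    (cut-head f (weaken (⊆-reflexive-↭ (++-comm Γ [ A ⇒ B ])) ⊆-refl (cut-head a (mp A B))))

⊩-theorem : [] ⊩ A → Γ ⊩ A
⊩-theorem = weaken (λ ()) ⊆-refl

⊩-there : Γ ⊩ A → B ∷ Γ ⊩ A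
⊩-there = weaken (xs⊆x∷xs _ _) ⊆-refl

⇒-refl : [] ⊩ A ⇒ A
⇒-refl {A = A} = ⊩-mp (⊩-mp (c2 A (A ⇒ A) A) (c1 A (A ⇒ A))) (c1 A A)

⊩-head : A ∷ Γ ⊩ A
⊩-head {A = A} =
  weaken (∈-∷⁺ʳ (here refl) (λ ())) ⊆-refl (cut {Δ = []} {Λ = [ A ]} ⇒-refl (mp A A))

data Ctx (k : ℕ) : Set where
  ε   : Ctx k
  _▸_ : Ctx k → Form k → Ctx k

infixl 4 _▸_

_⇛_ : Ctx k → Form k → Form k
ε ⇛ B       = B
(Ψ ▸ A) ⇛ B = Ψ ⇛ A ⇒ B

infixr 4 _⇛_

-- Ψ ⊢ᴴ A is the theorem A₁ ⇒ ⋯ ⇒ Aₙ ⇒ A for Ψ = ε ▸ A₁ ▸ ⋯ ▸ Aₙ, so that the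
-- deduction theorem ⇒-intro holds by definition.
record _⊢ᴴ_ (Ψ : Ctx k) (A : Form k) : Set where
  constructor ⟨_⟩
  field closed : [] ⊩ Ψ ⇛ A

open _⊢ᴴ_

infix 3 _⊢ᴴ_

private
  variable
    Ψ : Ctx k

mutual
  axiom : [] ⊩ A → Ψ ⊢ᴴ A
  axiom {Ψ = ε}             t = ⟨ t ⟩
  axiom {A = A} {Ψ = Ψ ▸ C} t = ⟨ closed (⇒-elim {Ψ = Ψ} (axiom (c1 A C)) (axiom t)) ⟩

  ⇒-elim : Ψ ⊢ᴴ A ⇒ B → Ψ ⊢ᴴ A → Ψ ⊢ᴴ B
  ⇒-elim {Ψ = ε} ⟨ f ⟩ ⟨ a ⟩ = ⟨ ⊩-mp f a ⟩
  ⇒-elim {Ψ = Ψ ▸ C} {A = A} {B = B} ⟨ f ⟩ ⟨ a ⟩ =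
    ⟨ closed (⇒-elim {Ψ = Ψ} (⇒-elim (axiom (c2 C A B)) ⟨ f ⟩) ⟨ a ⟩) ⟩

⇒-intro : Ψ ▸ A ⊢ᴴ B → Ψ ⊢ᴴ A ⇒ B
⇒-intro ⟨ t ⟩ = ⟨ t ⟩

weakenᴴ : Ψ ⊢ᴴ A → Ψ ▸ B ⊢ᴴ A
weakenᴴ {A = A} {B = B} t = ⟨ closed (⇒-elim (axiom (c1 A B)) t) ⟩

var₀ : Ψ ▸ A ⊢ᴴ A
var₀ {Ψ = Ψ} = ⟨ closed (axiom {Ψ = Ψ} ⇒-refl) ⟩

var₁ : Ψ ▸ A ▸ B ⊢ᴴ A
var₁ = weakenᴴ var₀

var₂ : Ψ ▸ A ▸ B ▸ C ⊢ᴴ A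
var₂ = weakenᴴ var₁

¬-elim : Ψ ⊢ᴴ A → Ψ ⊢ᴴ ¬ A → Ψ ⊢ᴴ B
¬-elim {A = A} {B = B} a na =
  ⇒-elim (⇒-elim (axiom (c3 B A)) (⇒-intro (weakenᴴ na))) (⇒-intro (weakenᴴ a))

¬¬-elim : Ψ ⊢ᴴ ¬ ¬ A → Ψ ⊢ᴴ A
¬¬-elim {A = A} h = ⇒-elim (⇒-elim (axiom (c3 A (¬ A))) (⇒-intro (weakenᴴ h))) (⇒-intro var₀)

¬-intro : Ψ ▸ A ⊢ᴴ B → Ψ ▸ A ⊢ᴴ ¬ B → Ψ ⊢ᴴ ¬ A
¬-intro {A = A} {B = B} p q =
  ⇒-elim (⇒-elim (axiom (c3 (¬ A) B)) (⇒-intro (under¬¬ q))) (⇒-intro (under¬¬ p))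
  where
    under¬¬ : Ψ ▸ A ⊢ᴴ C → Ψ ▸ ¬ ¬ A ⊢ᴴ C
    under¬¬ r = ⇒-elim (weakenᴴ (⇒-intro r)) (¬¬-elim var₀)

raa : Ψ ▸ ¬ A ⊢ᴴ B → Ψ ▸ ¬ A ⊢ᴴ ¬ B → Ψ ⊢ᴴ A
raa p q = ¬¬-elim (¬-intro p q)

¬¬-intro : Ψ ⊢ᴴ A → Ψ ⊢ᴴ ¬ ¬ A
¬¬-intro a = ¬-intro (weakenᴴ a) var₀

∧-intro : Ψ ⊢ᴴ A → Ψ ⊢ᴴ B → Ψ ⊢ᴴ A ∧ B
∧-intro a b = ¬-intro (weakenᴴ b) (⇒-elim var₀ (weakenᴴ (¬¬-intro a)))

∧-elimˡ : Ψ ⊢ᴴ A ∧ B → Ψ ⊢ᴴ A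
∧-elimˡ h = raa (⇒-intro (¬-elim var₁ var₀)) (weakenᴴ h)

∧-elimʳ : Ψ ⊢ᴴ A ∧ B → Ψ ⊢ᴴ B
∧-elimʳ h = raa (⇒-intro var₁) (weakenᴴ h)

⇔-intro : Ψ ▸ A ⊢ᴴ B → Ψ ▸ B ⊢ᴴ A → Ψ ⊢ᴴ A ⇔ B
⇔-intro f g = ∧-intro (⇒-intro f) (⇒-intro g)

⇔-elimˡ : Ψ ⊢ᴴ A ⇔ B → Ψ ⊢ᴴ A → Ψ ⊢ᴴ B
⇔-elimˡ h = ⇒-elim (∧-elimˡ h)

⇔-elimʳ : Ψ ⊢ᴴ A ⇔ B → Ψ ⊢ᴴ B → Ψ ⊢ᴴ A
⇔-elimʳ h = ⇒-elim (∧-elimʳ h)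

⇔-of-¬ : Ψ ⊢ᴴ ¬ A → Ψ ⊢ᴴ ¬ B → Ψ ⊢ᴴ A ⇔ B
⇔-of-¬ na nb = ⇔-intro (¬-elim var₀ (weakenᴴ na)) (¬-elim var₀ (weakenᴴ nb))

×ᶠ-of-true : ε ▸ A ⊢ᴴ χ ×ᶠ A
×ᶠ-of-true {A = A} {χ = χ} =
  ⇔-intro (⇒-elim (⇒-elim (axiom (b3 A χ)) var₀) var₁)
          (raa (¬-elim var₁ (⇒-elim (⇒-elim (axiom (b3 A (¬ χ))) ¬χ∣A) var₂)) var₀)
  where
    ¬χ∣A : ε ▸ A ▸ χ ▸ ¬ (χ ∣ A) ⊢ᴴ ¬ χ ∣ A
    ¬χ∣A = raa (⇔-elimˡ (axiom (b4 A χ)) var₀) var₁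

×ᶠ-of-¬∣ : ε ▸ ¬ X ▸ (¬ X ∣ Y) ⊢ᴴ X ×ᶠ Y
×ᶠ-of-¬∣ {X = X} {Y = Y} =
  ⇔-of-¬ (¬-intro (⇔-elimʳ (axiom (b4 Y X)) var₀) (¬¬-intro var₁)) var₁

theorem : ε ⊢ᴴ A → Γ ⊩ A
theorem = ⊩-theorem ∘ closed

infer₁ : ε ▸ A ⊢ᴴ B → Γ ⊩ A → Γ ⊩ B
infer₁ t = ⊩-mp (theorem (⇒-intro t))

infer₂ : ε ▸ A ▸ B ⊢ᴴ C → Γ ⊩ A → Γ ⊩ B → Γ ⊩ C
infer₂ t a = ⊩-mp (infer₁ (⇒-intro t) a)

⇔-sym : Γ ⊩ A ⇔ B → Γ ⊩ B ⇔ A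
⇔-sym = infer₁ (⇔-intro (⇔-elimʳ var₁ var₀) (⇔-elimˡ var₁ var₀))

⇔-trans : Γ ⊩ A ⇔ B → Γ ⊩ B ⇔ C → Γ ⊩ A ⇔ C
⇔-trans =
  infer₂ (⇔-intro (⇔-elimˡ var₁ (⇔-elimˡ var₂ var₀)) (⇔-elimʳ var₂ (⇔-elimʳ var₁ var₀)))

×ᶠ-sym : Γ ⊩ ψ ×ᶠ φ → Γ ⊩ φ ×ᶠ ψ
×ᶠ-sym {ψ = ψ} {φ = φ} p = ⊩-apply p (b5 φ ψ)

necessitation : Γ ⊩ χ → Γ ⊩ χ ∣ A
necessitation x = infer₂ (⇔-elimʳ var₀ var₁) x (×ᶠ-sym (infer₁ ×ᶠ-of-true x))

∣-distrib-⇒ : Γ ⊩ (X ⇒ Y) ∣ A → Γ ⊩ (X ∣ A) ⇒ (Y ∣ A)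
∣-distrib-⇒ {X = X} {Y = Y} {A = A} = ⊩-mp (⊩-theorem (b2 A X Y))

∣-map : ε ▸ X ⊢ᴴ Y → Γ ⊩ X ∣ A → Γ ⊩ Y ∣ A
∣-map t = ⊩-mp (∣-distrib-⇒ (necessitation (theorem (⇒-intro t))))

∣-congˡ : Γ ⊩ (X ⇔ Y) ∣ A → Γ ⊩ (X ∣ A) ⇔ (Y ∣ A)
∣-congˡ e = infer₂ (⇔-intro (⇒-elim var₂ var₀) (⇒-elim var₁ var₀))
  (∣-distrib-⇒ (∣-map (⇒-intro (⇔-elimˡ var₁ var₀)) e))
  (∣-distrib-⇒ (∣-map (⇒-intro (⇔-elimʳ var₁ var₀)) e))

∣-cases : Γ ⊩ A ⇒ X → ¬ A ∷ Γ ⊩ C → X ∣ A ∷ Γ ⊩ C → Γ ⊩ C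
∣-cases {A = A} {X = X} i = cases (⊩-apply i (b1 A X))

×ᶠ-of-false : Γ ⊩ ¬ A → Γ ⊩ χ ×ᶠ A
×ᶠ-of-false nA = ∣-cases (infer₁ (⇒-intro (weakenᴴ var₀)) nA)
  (infer₂ ×ᶠ-of-¬∣ ⊩-head (necessitation ⊩-head))
  (×ᶠ-sym (infer₂ ×ᶠ-of-¬∣ (⊩-there nA) ⊩-head))

×ᶠ-congˡ : Γ ⊩ ψ ⇔ η → Γ ⊩ ψ ×ᶠ χ → Γ ⊩ η ×ᶠ χ
×ᶠ-congˡ e p = ⇔-trans (⇔-sym (∣-congˡ (necessitation e))) (⇔-trans p e)

×ᶠ-congʳ : Γ ⊩ ψ ⇔ η → Γ ⊩ χ ×ᶠ ψ → Γ ⊩ χ ×ᶠ η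
×ᶠ-congʳ e = ×ᶠ-sym ∘ ×ᶠ-congˡ e ∘ ×ᶠ-sym

∣-idem : Γ ⊩ (φ ∣ ψ) ×ᶠ ψ
∣-idem = ∣-cases (theorem (⇒-intro ×ᶠ-of-true)) (×ᶠ-of-false ⊩-head) (∣-congˡ ⊩-head)

∣-congʳ : Γ ⊩ ψ ⇔ η → Γ ⊩ (φ ∣ ψ) ⇔ (φ ∣ η)
∣-congʳ {Γ = Γ} {ψ = ψ} {η = η} {φ = φ} e =
  ∣-cases η⇒φ×ᶠψ
    (⇔-trans (×ᶠ-of-false ¬ψ) (⇔-sym (×ᶠ-of-false ⊩-head)))
    (⇔-trans (⇔-sym (×ᶠ-congʳ (⊩-there e) ∣-idem)) (∣-congˡ ⊩-head))
  where
    η⇒φ×ᶠψ : Γ ⊩ η ⇒ φ ×ᶠ ψ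
    η⇒φ×ᶠψ =
      infer₁ (⇒-intro (⇒-elim (axiom (closed (⇒-intro ×ᶠ-of-true))) (⇔-elimʳ var₁ var₀))) e

    ¬ψ : ¬ η ∷ Γ ⊩ ¬ ψ
    ¬ψ = infer₂ (¬-intro (⇔-elimˡ var₂ var₀) var₁) (⊩-there e) ⊩-head

mainTheorem9 : (k : ℕ) (φ ψ η : Form k) →
    DBL ([ ψ ⇔ η ] ⊢ [ (φ ∣ ψ) ⇔ (φ ∣ η) ])
mainTheorem9 k φ ψ η = ∣-congʳ ⊩-head
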